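{- Let $u\in\Sigma_3^\omega$ be such that $f(u)$ is good and $u$ does not contain the factor $0110$. Then $u$ has a suffix of the form $h(W)$ for some $W\in\Sigma_3^\omega$.
   Context: $\Sigma_k=\{0,1,\dots,k-1\}$. The morphisms $f:\Sigma_3^*\to\Sigma_2^*$ and $h:\Sigma_3^*\to\Sigma_3^*$ are defined by $f(0)=0$, $f(1)=01$, $f(2)=011$; $h(0)=01$, $h(1)=02$, $h(2)=022$ (extended to infinite words letterwise). A finite word of length $n$ is rich if it has $n$ distinct nonempty palindromic factors; an infinite word is rich if all of its finite factors are rich. A word is $\alpha$-free if it has no nonempty factor $x$ with $|x|/p\ge\alpha$ for some period $p$ of $x$. A word in $\Sigma_2^\omega$ is called good if it is rich and $14/5$-free. -}

module Defs where

open import Data.Nat using (ℕ; zero; suc; _+_; _*_; _≤_; _∸_)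
open import Data.Fin using (Fin; toℕ) renaming (zero to fz; suc to fs)
open import Data.List using (List; []; _∷_; length; reverse; concatMap; filter; deduplicate; _++_; take; lookup)
import Data.List.Properties as LP
import Data.Fin.Properties as FP
open import Data.Product using (_×_; ∃; ∃-syntax)
open import Relation.Binary.PropositionalEquality using (_≡_)
open import Relation.Nullary using (¬_)

Σ : ℕ → Set
Σ k = Fin k

Word : ℕ → Set
Word k = List (Σ k)

InfWord : ℕ → Set
InfWord k = ℕ → Σ k

fac : ∀ {k} → InfWord k → ℕ → ℕ → Word k
fac u i zero    = []
fac u i (suc n) = u i ∷ fac u (suc i) n

pref : ∀ {k} → InfWord k → ℕ → Word k
pref u n = fac u 0 n

nth : ∀ {A : Set} → A → List A → ℕ → A
nth d []       _       = d
nth d (x ∷ xs) zero    = x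
nth d (x ∷ xs) (suc n) = nth d xs n

apply : ∀ {k m} → (Σ k → Word m) → Word k → Word m
apply σ w = concatMap σ w

-- morphism applied to an infinite word: letter i of σ(u) is letter i of
-- σ(u[0..i]); for non-erasing σ (as here) σ(u[0..i]) has length ≥ i+1,
-- so the default letter is never used.
applyω : ∀ {k m} → (Σ k → Word (suc m)) → InfWord k → InfWord (suc m)
applyω σ u i = nth fz (apply σ (pref u (suc i))) i

0₃ 1₃ 2₃ : Σ 3
0₃ = fz
1₃ = fs fz
2₃ = fs (fs fz)

0₂ 1₂ : Σ 2
0₂ = fz
1₂ = fs fz

f : Σ 3 → Word 2
f fz           = 0₂ ∷ []
f (fs fz)      = 0₂ ∷ 1₂ ∷ []
f (fs (fs fz)) = 0₂ ∷ 1₂ ∷ 1₂ ∷ []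

h : Σ 3 → Word 3
h fz           = 0₃ ∷ 1₃ ∷ []
h (fs fz)      = 0₃ ∷ 2₃ ∷ []
h (fs (fs fz)) = 0₃ ∷ 2₃ ∷ 2₃ ∷ []

Palindrome : ∀ {k} → Word k → Set
Palindrome w = reverse w ≡ w

nePrefixes : ∀ {A : Set} → List A → List (List A)
nePrefixes []       = []
nePrefixes (x ∷ xs) = (x ∷ []) ∷ Data.List.map (x ∷_) (nePrefixes xs)

neFactors : ∀ {A : Set} → List A → List (List A)
neFactors []       = []
neFactors (x ∷ xs) = nePrefixes (x ∷ xs) ++ neFactors xs

palFactors : ∀ {k} → Word k → List (Word k)
palFactors w =
  deduplicate (LP.≡-dec FP._≟_)
    (filter (λ v → LP.≡-dec FP._≟_ (reverse v) v) (neFactors w))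

Rich : ∀ {k} → Word k → Set
Rich w = length (palFactors w) ≡ length w

RichInf : ∀ {k} → InfWord k → Set
RichInf u = ∀ i n → Rich (fac u i n)

Period : ∀ {k} → Word k → ℕ → Set
Period x p = 1 ≤ p × (∀ (i j : Fin (length x)) → toℕ j ≡ toℕ i + p → lookup x i ≡ lookup x j)

-- x is a nonempty word with a period p such that |x|/p ≥ a/b
-- (i.e. b·|x| ≥ a·p)
HasPower : ∀ {k} → ℕ → ℕ → Word k → Set
HasPower a b x = 1 ≤ length x × ∃[ p ] (Period x p × a * p ≤ b * length x)

FreeInf : ∀ {k} → ℕ → ℕ → InfWord k → Set
FreeInf a b u = ∀ i n → ¬ HasPower a b (fac u i n)

Good : InfWord 2 → Set
Good w = RichInf w × FreeInf 14 5 w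

ContainsFactor : ∀ {k} → InfWord k → Word k → Set
ContainsFactor u v = ∃[ i ] (fac u i (length v) ≡ v)

w0110 : Word 3
w0110 = 0₃ ∷ 1₃ ∷ 1₃ ∷ 0₃ ∷ []

suffix : ∀ {k} → InfWord k → ℕ → InfWord k
suffix u n i = u (n + i)

-- Every f-image begins with 0, so an occurrence of P in u forces f(P)0 to occur in f(u).
-- A finite search over extensions of 00, 11, 12, 21 and 222 then shows that each of them
-- eventually ends in a factor P for which f(P)0 contains a non-rich window or a 14/5-power,
-- or in 0110; so none of them occurs in u. Without these factors every 0 of u starts a
-- block 01, 02 or 022 that is followed by another 0, and reading the blocks from the first
-- 0 on yields W with h(W) a suffix of u.
module Submission where

open import Defs
open import Data.Fin using (toℕ) renaming (zero to fz; suc to fs)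
import Data.Fin.Properties as FP
open import Data.List using (List; []; _∷_; _∷ʳ_; _++_; length; take; drop; lookup)
import Data.List.Properties as LP
open import Data.List.Relation.Binary.Pointwise using (Pointwise-≡⇒≡)
open import Data.List.Relation.Binary.Suffix.Heterogeneous using (Suffix; here; there)
open import Data.List.Relation.Binary.Suffix.Heterogeneous.Properties using (suffix?)
open import Data.List.Relation.Unary.All using (All; all?; lookupAny)
open import Data.List.Relation.Unary.Any using (Any; any?)
open import Data.Maybe using (Maybe; just; nothing; from-just)
open import Data.Nat using (ℕ; zero; suc; _+_; _*_; _∸_; _≤_; _<_; _≤?_; _≟_; z≤n; s≤s)
open import Data.Nat.Properties using (+-suc; +-identityʳ; +-assoc; +-mono-≤; ≤-total; ≤-trans; ≤-reflexive; m+[n∸m]≡n)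
open import Data.Product using (∃-syntax; _×_; _,_; proj₁; proj₂; curry)
open import Data.Sum using (inj₁; inj₂)
open import Data.Unit using (⊤)
open import Data.Empty using (⊥-elim)
open import Function using (_∘_)
open import Relation.Binary.PropositionalEquality using (_≡_; refl; sym; trans; cong; cong₂; subst; module ≡-Reasoning)
open import Relation.Nullary using (Dec; yes; no; ¬_)
open import Relation.Nullary.Decidable using (from-yes; ¬?; _×-dec_; _→-dec_)

OccursAt : ∀ {k} → InfWord k → ℕ → Word k → Set
OccursAt g i w = fac g i (length w) ≡ w

Avoids : ∀ {k} → InfWord k → Word k → Set
Avoids g w = ∀ i → ¬ OccursAt g i w

slice : ∀ {A : Set} → ℕ → ℕ → List A → List A
slice s L w = take L (drop s w)

nth-++ˡ : ∀ {A : Set} (d : A) (xs ys : List A) {j} → j < length xs → nth d (xs ++ ys) j ≡ nth d xs j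
nth-++ˡ d (x ∷ xs) ys {zero}  _        = refl
nth-++ˡ d (x ∷ xs) ys {suc j} (s≤s j<) = nth-++ˡ d xs ys j<

module _ {k} (g : InfWord k) where

  length-fac : ∀ i n → length (fac g i n) ≡ n
  length-fac i zero    = refl
  length-fac i (suc n) = cong suc (length-fac (suc i) n)

  fac-++ : ∀ i m n → fac g i (m + n) ≡ fac g i m ++ fac g (i + m) n
  fac-++ i zero    n rewrite +-identityʳ i = refl
  fac-++ i (suc m) n rewrite +-suc i m     = cong (g i ∷_) (fac-++ (suc i) m n)

  fac-∷ʳ : ∀ i n → fac g i (suc n) ≡ fac g i n ∷ʳ g (i + n)
  fac-∷ʳ i zero    rewrite +-identityʳ i = refl
  fac-∷ʳ i (suc n) rewrite +-suc i n     = cong (g i ∷_) (fac-∷ʳ (suc i) n)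

  occursAt-tail : ∀ {i a w} → OccursAt g i (a ∷ w) → OccursAt g (suc i) w
  occursAt-tail = LP.∷-injectiveʳ

  occursAt-++ : ∀ {i} xs {ys} → OccursAt g i xs → OccursAt g (i + length xs) ys → OccursAt g i (xs ++ ys)
  occursAt-++ {i} [] {ys} _ occ = subst (λ j → OccursAt g j ys) (+-identityʳ i) occ
  occursAt-++ {i} (x ∷ xs) {ys} occx occy =
    cong₂ _∷_ (LP.∷-injectiveˡ occx)
      (occursAt-++ xs (occursAt-tail occx) (subst (λ j → OccursAt g j ys) (+-suc i (length xs)) occy))

  occursAt-∷ʳ : ∀ {i w} → OccursAt g i w → OccursAt g i (w ∷ʳ g (i + length w))
  occursAt-∷ʳ {w = w} occ = occursAt-++ w occ refl

  occursAt-++⁻ˡ : ∀ {i} xs {ys} → OccursAt g i (xs ++ ys) → OccursAt g i xs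
  occursAt-++⁻ˡ []       _   = refl
  occursAt-++⁻ˡ (x ∷ xs) occ = cong₂ _∷_ (LP.∷-injectiveˡ occ) (occursAt-++⁻ˡ xs (occursAt-tail occ))

  occursAt-++⁻ʳ : ∀ {i} xs {ys} → OccursAt g i (xs ++ ys) → OccursAt g (i + length xs) ys
  occursAt-++⁻ʳ {i} [] {ys} occ = subst (λ j → OccursAt g j ys) (sym (+-identityʳ i)) occ
  occursAt-++⁻ʳ {i} (x ∷ xs) {ys} occ =
    subst (λ j → OccursAt g j ys) (sym (+-suc i (length xs))) (occursAt-++⁻ʳ xs (occursAt-tail occ))

  occursAt-suffix : ∀ {i v w} → Suffix _≡_ v w → OccursAt g i w → ∃[ j ] OccursAt g j v
  occursAt-suffix {i} (here v≋w) occ = i , subst (OccursAt g i) (sym (Pointwise-≡⇒≡ v≋w)) occ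
  occursAt-suffix (there suf)    occ = occursAt-suffix suf (occursAt-tail occ)

  occursAt-take : ∀ {i w} L → OccursAt g i w → L ≤ length w → fac g i L ≡ take L w
  occursAt-take zero    _   _ = refl
  occursAt-take {w = a ∷ w} (suc L) occ (s≤s L≤) =
    cong₂ _∷_ (LP.∷-injectiveˡ occ) (occursAt-take L (occursAt-tail occ) L≤)

  occursAt-slice : ∀ {i w} s L → OccursAt g i w → s + L ≤ length w → fac g (i + s) L ≡ slice s L w
  occursAt-slice {i} zero L occ fits rewrite +-identityʳ i = occursAt-take L occ fits
  occursAt-slice {i} {a ∷ w} (suc s) L occ (s≤s fits) rewrite +-suc i s =
    occursAt-slice s L (occursAt-tail occ) fits

  occursAt⇒nth : ∀ d {i w j} → OccursAt g i w → j < length w → g (i + j) ≡ nth d w j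
  occursAt⇒nth d {i} {a ∷ w} {zero} occ _ rewrite +-identityʳ i = LP.∷-injectiveˡ occ
  occursAt⇒nth d {i} {a ∷ w} {suc j} occ (s≤s j<) rewrite +-suc i j =
    occursAt⇒nth d (occursAt-tail occ) j<

  nth⇒occursAt : ∀ d {i} w → (∀ j → j < length w → g (i + j) ≡ nth d w j) → OccursAt g i w
  nth⇒occursAt d {i} [] _ = refl
  nth⇒occursAt d {i} (a ∷ w) agree =
    cong₂ _∷_ (subst (λ j → g j ≡ a) (+-identityʳ i) (agree 0 (s≤s z≤n)))
      (nth⇒occursAt d w λ j j< → subst (λ m → g m ≡ nth d w j) (+-suc i j) (agree (suc j) (s≤s j<)))

apply-pref-suc : ∀ {k m} (σ : Σ k → Word m) (w : InfWord k) j
               → apply σ (pref w (suc j)) ≡ apply σ (pref w j) ++ σ (w j)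
apply-pref-suc σ w j = begin
  apply σ (pref w (suc j))            ≡⟨ cong (apply σ) (fac-∷ʳ w 0 j) ⟩
  apply σ (pref w j ∷ʳ w j)           ≡⟨ LP.concatMap-++ σ (pref w j) (w j ∷ []) ⟩
  apply σ (pref w j) ++ σ (w j) ++ [] ≡⟨ cong (apply σ (pref w j) ++_) (LP.++-identityʳ (σ (w j))) ⟩
  apply σ (pref w j) ++ σ (w j)       ∎
  where open ≡-Reasoning

module NonErasing {k m} (σ : Σ k → Word (suc m)) (nonErasing : ∀ a → 1 ≤ length (σ a)) where

  length-apply : ∀ w → length w ≤ length (apply σ w)
  length-apply []      = z≤n
  length-apply (a ∷ w) = subst (suc (length w) ≤_) (sym (LP.length-++ (σ a)))
                           (+-mono-≤ (nonErasing a) (length-apply w))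

  index<length-apply-pref : ∀ (u : InfWord k) j → j < length (apply σ (pref u (suc j)))
  index<length-apply-pref u j =
    ≤-trans (≤-reflexive (sym (length-fac u 0 (suc j)))) (length-apply (pref u (suc j)))

  nth-apply-pref-mono : ∀ (u : InfWord k) {N M} j → N ≤ M → j < length (apply σ (pref u N))
                      → nth fz (apply σ (pref u M)) j ≡ nth fz (apply σ (pref u N)) j
  nth-apply-pref-mono u {N} {M} j N≤M j< = begin
    nth fz (apply σ (pref u M)) j
      ≡⟨ cong (λ n → nth fz (apply σ (pref u n)) j) (sym (m+[n∸m]≡n N≤M)) ⟩
    nth fz (apply σ (pref u (N + (M ∸ N)))) j
      ≡⟨ cong (λ v → nth fz (apply σ v) j) (fac-++ u 0 N (M ∸ N)) ⟩
    nth fz (apply σ (pref u N ++ fac u N (M ∸ N))) j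
      ≡⟨ cong (λ v → nth fz v j) (LP.concatMap-++ σ (pref u N) (fac u N (M ∸ N))) ⟩
    nth fz (apply σ (pref u N) ++ apply σ (fac u N (M ∸ N))) j
      ≡⟨ nth-++ˡ fz (apply σ (pref u N)) _ j< ⟩
    nth fz (apply σ (pref u N)) j ∎
    where open ≡-Reasoning

  applyω-nth : ∀ (u : InfWord k) N {j} → j < length (apply σ (pref u N))
             → applyω σ u j ≡ nth fz (apply σ (pref u N)) j
  applyω-nth u N {j} j< with ≤-total N (suc j)
  ... | inj₁ N≤ = nth-apply-pref-mono u j N≤ j<
  ... | inj₂ ≤N = sym (nth-apply-pref-mono u j ≤N (index<length-apply-pref u j))

  occursAt-apply-pref : ∀ (u : InfWord k) N → OccursAt (applyω σ u) 0 (apply σ (pref u N))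
  occursAt-apply-pref u N = nth⇒occursAt (applyω σ u) fz (apply σ (pref u N)) λ j → applyω-nth u N

  occursAt-apply : ∀ (u : InfWord k) i n
                 → OccursAt (applyω σ u) (length (apply σ (pref u i))) (apply σ (fac u i n))
  occursAt-apply u i n = occursAt-++⁻ʳ (applyω σ u) (apply σ (pref u i))
    (subst (OccursAt (applyω σ u) 0) split (occursAt-apply-pref u (i + n)))
    where
    split : apply σ (pref u (i + n)) ≡ apply σ (pref u i) ++ apply σ (fac u i n)
    split = trans (cong (apply σ) (fac-++ u 0 i n)) (LP.concatMap-++ σ (pref u i) (fac u i n))

  suffix≡applyω : ∀ {u : InfWord (suc m)} {W : InfWord k} n
                → (∀ j → OccursAt u n (apply σ (pref W j))) → ∀ i → suffix u n i ≡ applyω σ W i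
  suffix≡applyω {u} {W} n parsed i = occursAt⇒nth u fz (parsed (suc i)) (index<length-apply-pref W i)

f-nonErasing : ∀ a → 1 ≤ length (f a)
f-nonErasing fz           = s≤s z≤n
f-nonErasing (fs fz)      = s≤s z≤n
f-nonErasing (fs (fs fz)) = s≤s z≤n

h-nonErasing : ∀ a → 1 ≤ length (h a)
h-nonErasing fz           = s≤s z≤n
h-nonErasing (fs fz)      = s≤s z≤n
h-nonErasing (fs (fs fz)) = s≤s z≤n

imageWindow : Word 3 → Word 2
imageWindow P = apply f P ∷ʳ 0₂

apply-f-singleton : ∀ c → apply f (c ∷ []) ≡ 0₂ ∷ drop 1 (f c)
apply-f-singleton fz           = refl
apply-f-singleton (fs fz)      = refl
apply-f-singleton (fs (fs fz)) = refl

apply-f-∷ʳ : ∀ P c → apply f (P ∷ʳ c) ≡ imageWindow P ++ drop 1 (f c)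
apply-f-∷ʳ P c = begin
  apply f (P ∷ʳ c)                      ≡⟨ LP.concatMap-++ f P (c ∷ []) ⟩
  apply f P ++ apply f (c ∷ [])         ≡⟨ cong (apply f P ++_) (apply-f-singleton c) ⟩
  apply f P ++ 0₂ ∷ drop 1 (f c)        ≡⟨ sym (LP.∷ʳ-++ (apply f P) 0₂ (drop 1 (f c))) ⟩
  imageWindow P ++ drop 1 (f c)         ∎
  where open ≡-Reasoning

occursAt-imageWindow : ∀ {u : InfWord 3} {i P} → OccursAt u i P
                     → OccursAt (applyω f u) (length (apply f (pref u i))) (imageWindow P)
occursAt-imageWindow {u} {i} {P} occ =
  occursAt-++⁻ˡ (applyω f u) (imageWindow P)
    (subst (OccursAt (applyω f u) _) image (NonErasing.occursAt-apply f f-nonErasing u i (suc (length P))))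
  where
  image : apply f (fac u i (suc (length P))) ≡ imageWindow P ++ drop 1 (f (u (i + length P)))
  image = trans (cong (apply f) (trans (fac-∷ʳ u i (length P)) (cong (_∷ʳ u (i + length P)) occ)))
                (apply-f-∷ʳ P (u (i + length P)))

-- An obstruction names a word P and the evidence that P cannot occur in u:
-- a window [s, s + L) of f(P)0 that is not rich, or that has period p with 14 p ≤ 5 L.
data Obstruction : Set where
  nonRich    : (P : Word 3) (s L : ℕ) → Obstruction
  power      : (P : Word 3) (s L p : ℕ) → Obstruction
  factor0110 : Obstruction

forbidden : Obstruction → Word 3
forbidden (nonRich P _ _) = P
forbidden (power P _ _ _) = P
forbidden factor0110      = w0110

Valid : Obstruction → Set
Valid (nonRich P s L) = s + L ≤ length (imageWindow P) × ¬ Rich (slice s L (imageWindow P))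
Valid (power P s L p) = s + L ≤ length (imageWindow P) × 1 ≤ length x × Period x p × 14 * p ≤ 5 * length x
  where x = slice s L (imageWindow P)
Valid factor0110      = ⊤

period? : ∀ {k} (x : Word k) p → Dec (Period x p)
period? x p = 1 ≤? p ×-dec FP.all? λ i → FP.all? λ j →
  (toℕ j ≟ toℕ i + p) →-dec (lookup x i FP.≟ lookup x j)

valid? : ∀ e → Dec (Valid e)
valid? (nonRich P s L) = s + L ≤? length (imageWindow P) ×-dec ¬? (length (palFactors x) ≟ length x)
  where x = slice s L (imageWindow P)
valid? (power P s L p) =
  s + L ≤? length (imageWindow P) ×-dec 1 ≤? length x ×-dec period? x p ×-dec 14 * p ≤? 5 * length x
  where x = slice s L (imageWindow P)
valid? factor0110      = yes _

obstructions : List Obstruction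
obstructions =
    power (0₃ ∷ 0₃ ∷ []) 0 3 1
  ∷ power (0₃ ∷ 0₃ ∷ 1₃ ∷ []) 0 3 1
  ∷ power (0₃ ∷ 0₃ ∷ 2₃ ∷ []) 0 3 1
  ∷ power (1₃ ∷ 1₃ ∷ 1₃ ∷ []) 0 6 2
  ∷ power (1₃ ∷ 1₃ ∷ 2₃ ∷ []) 0 6 2
  ∷ power (2₃ ∷ 1₃ ∷ 1₃ ∷ []) 2 6 2
  ∷ power (2₃ ∷ 2₃ ∷ 2₃ ∷ []) 0 9 3
  ∷ factor0110
  ∷ nonRich (0₃ ∷ 1₃ ∷ 2₃ ∷ 0₃ ∷ []) 0 8
  ∷ nonRich (0₃ ∷ 2₃ ∷ 1₃ ∷ 0₃ ∷ []) 0 8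
  ∷ nonRich (1₃ ∷ 0₃ ∷ 2₃ ∷ 1₃ ∷ []) 0 9
  ∷ nonRich (1₃ ∷ 2₃ ∷ 0₃ ∷ 1₃ ∷ []) 0 9
  ∷ power (1₃ ∷ 2₃ ∷ 2₃ ∷ 1₃ ∷ []) 1 9 3
  ∷ nonRich (2₃ ∷ 0₃ ∷ 1₃ ∷ 2₃ ∷ []) 1 8
  ∷ nonRich (2₃ ∷ 1₃ ∷ 0₃ ∷ 2₃ ∷ []) 1 8
  ∷ power (2₃ ∷ 2₃ ∷ 2₃ ∷ 0₃ ∷ []) 0 9 3
  ∷ power (2₃ ∷ 2₃ ∷ 2₃ ∷ 1₃ ∷ []) 0 9 3
  ∷ nonRich (0₃ ∷ 1₃ ∷ 2₃ ∷ 2₃ ∷ 0₃ ∷ []) 0 11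
  ∷ nonRich (0₃ ∷ 2₃ ∷ 2₃ ∷ 1₃ ∷ 0₃ ∷ []) 0 11
  ∷ power (1₃ ∷ 0₃ ∷ 1₃ ∷ 0₃ ∷ 1₃ ∷ []) 0 9 3
  ∷ nonRich (1₃ ∷ 1₃ ∷ 0₃ ∷ 2₃ ∷ 2₃ ∷ []) 1 9
  ∷ nonRich (1₃ ∷ 2₃ ∷ 2₃ ∷ 0₃ ∷ 1₃ ∷ []) 0 12
  ∷ power (2₃ ∷ 0₃ ∷ 2₃ ∷ 0₃ ∷ 2₃ ∷ []) 0 12 4
  ∷ power (2₃ ∷ 1₃ ∷ 2₃ ∷ 1₃ ∷ 2₃ ∷ []) 0 14 5
  ∷ nonRich (0₃ ∷ 1₃ ∷ 2₃ ∷ 1₃ ∷ 2₃ ∷ 0₃ ∷ []) 0 13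
  ∷ nonRich (0₃ ∷ 2₃ ∷ 1₃ ∷ 2₃ ∷ 1₃ ∷ 0₃ ∷ []) 0 13
  ∷ nonRich (0₃ ∷ 2₃ ∷ 1₃ ∷ 2₃ ∷ 2₃ ∷ 0₃ ∷ []) 0 14
  ∷ nonRich (0₃ ∷ 2₃ ∷ 2₃ ∷ 1₃ ∷ 2₃ ∷ 0₃ ∷ []) 0 14
  ∷ nonRich (1₃ ∷ 0₃ ∷ 2₃ ∷ 0₃ ∷ 2₃ ∷ 1₃ ∷ []) 0 13
  ∷ nonRich (1₃ ∷ 2₃ ∷ 0₃ ∷ 2₃ ∷ 0₃ ∷ 1₃ ∷ []) 0 13
  ∷ nonRich (1₃ ∷ 2₃ ∷ 0₃ ∷ 2₃ ∷ 2₃ ∷ 1₃ ∷ []) 0 15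
  ∷ nonRich (1₃ ∷ 2₃ ∷ 2₃ ∷ 0₃ ∷ 2₃ ∷ 1₃ ∷ []) 0 15
  ∷ power (2₃ ∷ 0₃ ∷ 1₃ ∷ 0₃ ∷ 1₃ ∷ 0₃ ∷ []) 2 9 3
  ∷ nonRich (2₃ ∷ 0₃ ∷ 1₃ ∷ 0₃ ∷ 1₃ ∷ 2₃ ∷ []) 1 11
  ∷ nonRich (2₃ ∷ 1₃ ∷ 0₃ ∷ 1₃ ∷ 0₃ ∷ 2₃ ∷ []) 1 11
  ∷ nonRich (0₃ ∷ 1₃ ∷ 2₃ ∷ 1₃ ∷ 2₃ ∷ 2₃ ∷ 0₃ ∷ []) 0 16
  ∷ nonRich (0₃ ∷ 2₃ ∷ 2₃ ∷ 1₃ ∷ 2₃ ∷ 1₃ ∷ 0₃ ∷ []) 0 16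
  ∷ power (1₃ ∷ 0₃ ∷ 2₃ ∷ 0₃ ∷ 2₃ ∷ 0₃ ∷ 1₃ ∷ []) 1 12 4
  ∷ nonRich (1₃ ∷ 1₃ ∷ 0₃ ∷ 1₃ ∷ 0₃ ∷ 2₃ ∷ 2₃ ∷ []) 1 12
  ∷ nonRich (1₃ ∷ 1₃ ∷ 0₃ ∷ 2₃ ∷ 0₃ ∷ 2₃ ∷ 2₃ ∷ []) 1 13
  ∷ nonRich (1₃ ∷ 2₃ ∷ 0₃ ∷ 2₃ ∷ 2₃ ∷ 0₃ ∷ 1₃ ∷ []) 0 16
  ∷ nonRich (1₃ ∷ 2₃ ∷ 2₃ ∷ 0₃ ∷ 2₃ ∷ 0₃ ∷ 1₃ ∷ []) 0 16
  ∷ nonRich (2₃ ∷ 2₃ ∷ 0₃ ∷ 2₃ ∷ 1₃ ∷ 2₃ ∷ 2₃ ∷ []) 1 17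
  ∷ nonRich (1₃ ∷ 2₃ ∷ 2₃ ∷ 0₃ ∷ 2₃ ∷ 2₃ ∷ 0₃ ∷ 1₃ ∷ []) 0 19
  ∷ power (2₃ ∷ 2₃ ∷ 0₃ ∷ 2₃ ∷ 2₃ ∷ 0₃ ∷ 2₃ ∷ 2₃ ∷ []) 0 20 7
  ∷ nonRich (1₃ ∷ 1₃ ∷ 0₃ ∷ 1₃ ∷ 0₃ ∷ 2₃ ∷ 0₃ ∷ 1₃ ∷ 1₃ ∷ []) 1 15
  ∷ nonRich (1₃ ∷ 1₃ ∷ 0₃ ∷ 1₃ ∷ 0₃ ∷ 2₃ ∷ 0₃ ∷ 2₃ ∷ 2₃ ∷ []) 1 16
  ∷ nonRich (1₃ ∷ 1₃ ∷ 0₃ ∷ 2₃ ∷ 0₃ ∷ 1₃ ∷ 0₃ ∷ 1₃ ∷ 1₃ ∷ []) 1 15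
  ∷ nonRich (1₃ ∷ 1₃ ∷ 0₃ ∷ 2₃ ∷ 0₃ ∷ 1₃ ∷ 0₃ ∷ 2₃ ∷ 2₃ ∷ []) 1 16
  ∷ nonRich (1₃ ∷ 2₃ ∷ 0₃ ∷ 2₃ ∷ 2₃ ∷ 0₃ ∷ 2₃ ∷ 0₃ ∷ 1₃ ∷ []) 0 20
  ∷ power (1₃ ∷ 2₃ ∷ 0₃ ∷ 2₃ ∷ 2₃ ∷ 0₃ ∷ 2₃ ∷ 2₃ ∷ 0₃ ∷ []) 1 20 7
  ∷ nonRich (1₃ ∷ 2₃ ∷ 0₃ ∷ 2₃ ∷ 2₃ ∷ 0₃ ∷ 2₃ ∷ 2₃ ∷ 1₃ ∷ []) 0 22
  ∷ nonRich (1₃ ∷ 2₃ ∷ 2₃ ∷ 0₃ ∷ 2₃ ∷ 2₃ ∷ 0₃ ∷ 2₃ ∷ 1₃ ∷ []) 0 22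
  ∷ nonRich (1₃ ∷ 2₃ ∷ 2₃ ∷ 0₃ ∷ 2₃ ∷ 2₃ ∷ 0₃ ∷ 2₃ ∷ 0₃ ∷ 1₃ ∷ []) 0 23
  ∷ power (1₃ ∷ 0₃ ∷ 2₃ ∷ 0₃ ∷ 1₃ ∷ 0₃ ∷ 2₃ ∷ 0₃ ∷ 1₃ ∷ 0₃ ∷ 2₃ ∷ []) 0 20 7
  ∷ nonRich (1₃ ∷ 1₃ ∷ 0₃ ∷ 1₃ ∷ 0₃ ∷ 2₃ ∷ 0₃ ∷ 1₃ ∷ 0₃ ∷ 2₃ ∷ 2₃ ∷ []) 1 19
  ∷ nonRich (1₃ ∷ 1₃ ∷ 0₃ ∷ 2₃ ∷ 0₃ ∷ 1₃ ∷ 0₃ ∷ 2₃ ∷ 0₃ ∷ 2₃ ∷ 2₃ ∷ []) 1 20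
  ∷ power (1₃ ∷ 2₃ ∷ 1₃ ∷ 0₃ ∷ 1₃ ∷ 2₃ ∷ 1₃ ∷ 0₃ ∷ 1₃ ∷ 2₃ ∷ 1₃ ∷ []) 0 23 8
  ∷ power (1₃ ∷ 2₃ ∷ 1₃ ∷ 0₃ ∷ 1₃ ∷ 2₃ ∷ 1₃ ∷ 0₃ ∷ 1₃ ∷ 2₃ ∷ 2₃ ∷ []) 0 23 8
  ∷ power (2₃ ∷ 0₃ ∷ 2₃ ∷ 1₃ ∷ 2₃ ∷ 0₃ ∷ 2₃ ∷ 1₃ ∷ 2₃ ∷ 0₃ ∷ 2₃ ∷ []) 0 26 9
  ∷ power (2₃ ∷ 1₃ ∷ 0₃ ∷ 1₃ ∷ 2₃ ∷ 1₃ ∷ 0₃ ∷ 1₃ ∷ 2₃ ∷ 1₃ ∷ 0₃ ∷ []) 0 23 8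
  ∷ power (2₃ ∷ 1₃ ∷ 2₃ ∷ 0₃ ∷ 2₃ ∷ 1₃ ∷ 2₃ ∷ 0₃ ∷ 2₃ ∷ 1₃ ∷ 2₃ ∷ []) 0 26 9
  ∷ nonRich (2₃ ∷ 2₃ ∷ 0₃ ∷ 2₃ ∷ 1₃ ∷ 2₃ ∷ 0₃ ∷ 2₃ ∷ 1₃ ∷ 2₃ ∷ 2₃ ∷ []) 1 26
  ∷ power (1₃ ∷ 0₃ ∷ 1₃ ∷ 0₃ ∷ 2₃ ∷ 0₃ ∷ 1₃ ∷ 0₃ ∷ 2₃ ∷ 0₃ ∷ 1₃ ∷ 0₃ ∷ []) 1 20 7
  ∷ power (1₃ ∷ 1₃ ∷ 0₃ ∷ 1₃ ∷ 2₃ ∷ 1₃ ∷ 0₃ ∷ 1₃ ∷ 2₃ ∷ 1₃ ∷ 0₃ ∷ 1₃ ∷ []) 1 23 8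
  ∷ nonRich (1₃ ∷ 1₃ ∷ 0₃ ∷ 1₃ ∷ 0₃ ∷ 2₃ ∷ 0₃ ∷ 1₃ ∷ 0₃ ∷ 2₃ ∷ 0₃ ∷ 1₃ ∷ 1₃ ∷ []) 1 22
  ∷ nonRich (1₃ ∷ 1₃ ∷ 0₃ ∷ 1₃ ∷ 0₃ ∷ 2₃ ∷ 0₃ ∷ 1₃ ∷ 0₃ ∷ 2₃ ∷ 0₃ ∷ 2₃ ∷ 2₃ ∷ []) 1 23
  ∷ nonRich (1₃ ∷ 1₃ ∷ 0₃ ∷ 2₃ ∷ 0₃ ∷ 1₃ ∷ 0₃ ∷ 2₃ ∷ 0₃ ∷ 1₃ ∷ 0₃ ∷ 1₃ ∷ 1₃ ∷ []) 1 22
  ∷ nonRich (1₃ ∷ 1₃ ∷ 0₃ ∷ 1₃ ∷ 2₃ ∷ 1₃ ∷ 0₃ ∷ 1₃ ∷ 2₃ ∷ 1₃ ∷ 2₃ ∷ 1₃ ∷ 0₃ ∷ 1₃ ∷ 1₃ ∷ []) 0 31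
  ∷ nonRich (1₃ ∷ 1₃ ∷ 0₃ ∷ 1₃ ∷ 2₃ ∷ 1₃ ∷ 2₃ ∷ 1₃ ∷ 0₃ ∷ 1₃ ∷ 2₃ ∷ 1₃ ∷ 0₃ ∷ 1₃ ∷ 1₃ ∷ []) 0 31
  ∷ nonRich (1₃ ∷ 2₃ ∷ 1₃ ∷ 2₃ ∷ 0₃ ∷ 2₃ ∷ 1₃ ∷ 2₃ ∷ 0₃ ∷ 2₃ ∷ 2₃ ∷ 0₃ ∷ 2₃ ∷ 1₃ ∷ 2₃ ∷ 1₃ ∷ []) 1 36
  ∷ nonRich (1₃ ∷ 2₃ ∷ 1₃ ∷ 2₃ ∷ 0₃ ∷ 2₃ ∷ 2₃ ∷ 0₃ ∷ 2₃ ∷ 1₃ ∷ 2₃ ∷ 0₃ ∷ 2₃ ∷ 1₃ ∷ 2₃ ∷ 1₃ ∷ []) 1 36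
  ∷ power (1₃ ∷ 2₃ ∷ 1₃ ∷ 2₃ ∷ 1₃ ∷ 0₃ ∷ 1₃ ∷ 2₃ ∷ 1₃ ∷ 2₃ ∷ 1₃ ∷ 0₃ ∷ 1₃ ∷ 2₃ ∷ 1₃ ∷ 2₃ ∷ []) 0 37 13
  ∷ power (2₃ ∷ 1₃ ∷ 2₃ ∷ 1₃ ∷ 0₃ ∷ 1₃ ∷ 2₃ ∷ 1₃ ∷ 2₃ ∷ 1₃ ∷ 0₃ ∷ 1₃ ∷ 2₃ ∷ 1₃ ∷ 2₃ ∷ 1₃ ∷ []) 0 37 13
  ∷ power (2₃ ∷ 1₃ ∷ 2₃ ∷ 2₃ ∷ 0₃ ∷ 2₃ ∷ 2₃ ∷ 1₃ ∷ 2₃ ∷ 2₃ ∷ 0₃ ∷ 2₃ ∷ 2₃ ∷ 1₃ ∷ 2₃ ∷ 2₃ ∷ []) 0 42 15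
  ∷ power (1₃ ∷ 0₃ ∷ 1₃ ∷ 2₃ ∷ 1₃ ∷ 2₃ ∷ 1₃ ∷ 0₃ ∷ 1₃ ∷ 2₃ ∷ 1₃ ∷ 2₃ ∷ 1₃ ∷ 0₃ ∷ 1₃ ∷ 2₃ ∷ 1₃ ∷ []) 0 37 13
  ∷ power (1₃ ∷ 2₃ ∷ 1₃ ∷ 0₃ ∷ 1₃ ∷ 2₃ ∷ 1₃ ∷ 2₃ ∷ 1₃ ∷ 0₃ ∷ 1₃ ∷ 2₃ ∷ 1₃ ∷ 2₃ ∷ 1₃ ∷ 0₃ ∷ 1₃ ∷ []) 0 37 13
  ∷ power (1₃ ∷ 2₃ ∷ 2₃ ∷ 0₃ ∷ 2₃ ∷ 2₃ ∷ 1₃ ∷ 2₃ ∷ 2₃ ∷ 0₃ ∷ 2₃ ∷ 2₃ ∷ 1₃ ∷ 2₃ ∷ 2₃ ∷ 0₃ ∷ 2₃ ∷ []) 0 42 15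
  ∷ power (2₃ ∷ 1₃ ∷ 0₃ ∷ 1₃ ∷ 2₃ ∷ 1₃ ∷ 2₃ ∷ 1₃ ∷ 0₃ ∷ 1₃ ∷ 2₃ ∷ 1₃ ∷ 2₃ ∷ 1₃ ∷ 0₃ ∷ 1₃ ∷ 2₃ ∷ []) 0 37 13
  ∷ power (1₃ ∷ 1₃ ∷ 0₃ ∷ 1₃ ∷ 2₃ ∷ 1₃ ∷ 2₃ ∷ 1₃ ∷ 0₃ ∷ 1₃ ∷ 2₃ ∷ 1₃ ∷ 2₃ ∷ 1₃ ∷ 0₃ ∷ 1₃ ∷ 2₃ ∷ 2₃ ∷ []) 1 37 13
  ∷ power (1₃ ∷ 2₃ ∷ 0₃ ∷ 2₃ ∷ 2₃ ∷ 0₃ ∷ 2₃ ∷ 1₃ ∷ 2₃ ∷ 0₃ ∷ 2₃ ∷ 2₃ ∷ 0₃ ∷ 2₃ ∷ 1₃ ∷ 2₃ ∷ 0₃ ∷ 2₃ ∷ 2₃ ∷ []) 0 45 16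
  ∷ power (2₃ ∷ 0₃ ∷ 2₃ ∷ 1₃ ∷ 2₃ ∷ 0₃ ∷ 2₃ ∷ 2₃ ∷ 0₃ ∷ 2₃ ∷ 1₃ ∷ 2₃ ∷ 0₃ ∷ 2₃ ∷ 2₃ ∷ 0₃ ∷ 2₃ ∷ 1₃ ∷ 2₃ ∷ []) 0 45 16
  ∷ power (2₃ ∷ 1₃ ∷ 2₃ ∷ 0₃ ∷ 2₃ ∷ 2₃ ∷ 0₃ ∷ 2₃ ∷ 1₃ ∷ 2₃ ∷ 0₃ ∷ 2₃ ∷ 2₃ ∷ 0₃ ∷ 2₃ ∷ 1₃ ∷ 2₃ ∷ 0₃ ∷ 2₃ ∷ []) 0 45 16
  ∷ []

obstructions-valid : All Valid obstructions
obstructions-valid = from-yes (all? valid? obstructions)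

data Doomed : Word 3 → Set where
  obstructed : ∀ {w} → Any (λ e → Suffix _≡_ (forbidden e) w) obstructions → Doomed w
  extensions : ∀ {w} → (∀ c → Doomed (w ∷ʳ c)) → Doomed w

doomed? : ℕ → (w : Word 3) → Maybe (Doomed w)
doomed? depth w with any? (λ e → suffix? FP._≟_ (forbidden e) w) obstructions
... | yes ends = just (obstructed ends)
doomed? zero        w | no _ = nothing
doomed? (suc depth) w | no _
  with doomed? depth (w ∷ʳ 0₃) | doomed? depth (w ∷ʳ 1₃) | doomed? depth (w ∷ʳ 2₃)
... | just d₀ | just d₁ | just d₂ =
  just (extensions λ { fz → d₀ ; (fs fz) → d₁ ; (fs (fs fz)) → d₂ })
... | _       | _       | _       = nothing

module Exclusion (u : InfWord 3) (good : Good (applyω f u)) (no0110 : Avoids u w0110) where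

  window-factor : ∀ {i P} s L → OccursAt u i P → s + L ≤ length (imageWindow P)
                → fac (applyω f u) (length (apply f (pref u i)) + s) L ≡ slice s L (imageWindow P)
  window-factor s L occ = occursAt-slice (applyω f u) s L (occursAt-imageWindow occ)

  valid-avoided : ∀ {e} → Valid e → Avoids u (forbidden e)
  valid-avoided {nonRich P s L} (fits , notRich) i occ =
    notRich (subst Rich (window-factor s L occ fits) (proj₁ good _ L))
  valid-avoided {power P s L p} (fits , nonempty , period , short) i occ =
    proj₂ good _ L (subst (HasPower 14 5) (sym (window-factor s L occ fits)) (nonempty , p , period , short))
  valid-avoided {factor0110} _ = no0110

  doomed-avoided : ∀ {w} → Doomed w → Avoids u w
  doomed-avoided (obstructed ends) i occ =
    let valid , suf = lookupAny obstructions-valid ends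
        j , occ′    = occursAt-suffix u suf occ
    in valid-avoided valid j occ′
  doomed-avoided (extensions next) i occ = doomed-avoided (next _) i (occursAt-∷ʳ u occ)

doomed-00 : Doomed (0₃ ∷ 0₃ ∷ [])
doomed-00 = from-just (doomed? 22 (0₃ ∷ 0₃ ∷ []))

doomed-11 : Doomed (1₃ ∷ 1₃ ∷ [])
doomed-11 = from-just (doomed? 22 (1₃ ∷ 1₃ ∷ []))

doomed-12 : Doomed (1₃ ∷ 2₃ ∷ [])
doomed-12 = from-just (doomed? 22 (1₃ ∷ 2₃ ∷ []))

doomed-21 : Doomed (2₃ ∷ 1₃ ∷ [])
doomed-21 = from-just (doomed? 22 (2₃ ∷ 1₃ ∷ []))

doomed-222 : Doomed (2₃ ∷ 2₃ ∷ 2₃ ∷ [])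
doomed-222 = from-just (doomed? 22 (2₃ ∷ 2₃ ∷ 2₃ ∷ []))

-- The letter c such that h(c) is the block starting at a 0 followed by a and b.
blockLetter : Σ 3 → Σ 3 → Σ 3
blockLetter (fs fz)      _            = 0₃
blockLetter (fs (fs fz)) (fs (fs fz)) = 2₃
blockLetter _            _            = 1₃

module Parsing (u : InfWord 3)
  (no00 : Avoids u (0₃ ∷ 0₃ ∷ [])) (no11 : Avoids u (1₃ ∷ 1₃ ∷ []))
  (no12 : Avoids u (1₃ ∷ 2₃ ∷ [])) (no21 : Avoids u (2₃ ∷ 1₃ ∷ []))
  (no222 : Avoids u (2₃ ∷ 2₃ ∷ 2₃ ∷ [])) where

  at₂ : ∀ {i a b} → u i ≡ a → u (suc i) ≡ b → OccursAt u i (a ∷ b ∷ [])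
  at₂ eₐ e_b = cong₂ _∷_ eₐ (cong₂ _∷_ e_b refl)

  at₃ : ∀ {i a b c} → u i ≡ a → u (suc i) ≡ b → u (suc (suc i)) ≡ c
      → OccursAt u i (a ∷ b ∷ c ∷ [])
  at₃ eₐ e_b e_c = cong₂ _∷_ eₐ (at₂ e_b e_c)

  firstZero : ∃[ n ] u n ≡ 0₃
  firstZero = search (u 0) (u 1) (u 2) refl refl refl
    where
    search : ∀ a b c → u 0 ≡ a → u 1 ≡ b → u 2 ≡ c → ∃[ n ] u n ≡ 0₃
    search fz           _            _            eₐ _   _   = 0 , eₐ
    search (fs _)       fz           _            _  e_b _   = 1 , e_b
    search (fs fz)      (fs fz)      _            eₐ e_b _   = ⊥-elim (no11 0 (at₂ eₐ e_b))
    search (fs fz)      (fs (fs fz)) _            eₐ e_b _   = ⊥-elim (no12 0 (at₂ eₐ e_b))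
    search (fs (fs fz)) (fs fz)      _            eₐ e_b _   = ⊥-elim (no21 0 (at₂ eₐ e_b))
    search (fs (fs fz)) (fs (fs fz)) fz           _  _   e_c = 2 , e_c
    search (fs (fs fz)) (fs (fs fz)) (fs fz)      _  e_b e_c = ⊥-elim (no21 1 (at₂ e_b e_c))
    search (fs (fs fz)) (fs (fs fz)) (fs (fs fz)) eₐ e_b e_c = ⊥-elim (no222 0 (at₃ eₐ e_b e_c))

  blockAt : ℕ → Σ 3
  blockAt p = blockLetter (u (suc p)) (u (suc (suc p)))

  block-step′ : ∀ {p} a b → u p ≡ 0₃ → u (suc p) ≡ a → u (suc (suc p)) ≡ b
              → OccursAt u p (h (blockLetter a b) ∷ʳ 0₃)
  block-step′ {p} fz           _            e₀ eₐ _   = ⊥-elim (no00 p (at₂ e₀ eₐ))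
  block-step′ {p} (fs fz)      fz           e₀ eₐ e_b = at₃ e₀ eₐ e_b
  block-step′ {p} (fs fz)      (fs fz)      _  eₐ e_b = ⊥-elim (no11 (suc p) (at₂ eₐ e_b))
  block-step′ {p} (fs fz)      (fs (fs fz)) _  eₐ e_b = ⊥-elim (no12 (suc p) (at₂ eₐ e_b))
  block-step′ {p} (fs (fs fz)) fz           e₀ eₐ e_b = at₃ e₀ eₐ e_b
  block-step′ {p} (fs (fs fz)) (fs fz)      _  eₐ e_b = ⊥-elim (no21 (suc p) (at₂ eₐ e_b))
  block-step′ {p} (fs (fs fz)) (fs (fs fz)) e₀ eₐ e_b = fourth (u (3 + p)) refl
    where
    fourth : ∀ c → u (3 + p) ≡ c → OccursAt u p (0₃ ∷ 2₃ ∷ 2₃ ∷ 0₃ ∷ [])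
    fourth fz           e_c = cong₂ _∷_ e₀ (at₃ eₐ e_b e_c)
    fourth (fs fz)      e_c = ⊥-elim (no21 (2 + p) (at₂ e_b e_c))
    fourth (fs (fs fz)) e_c = ⊥-elim (no222 (suc p) (at₃ eₐ e_b e_c))

  block-step : ∀ p → u p ≡ 0₃ → OccursAt u p (h (blockAt p) ∷ʳ 0₃)
  block-step p e₀ = block-step′ _ _ e₀ refl refl

  n₀ : ℕ
  n₀ = proj₁ firstZero

  pos : ℕ → ℕ
  pos zero    = n₀
  pos (suc j) = pos j + length (h (blockAt (pos j)))

  W : InfWord 3
  W j = blockAt (pos j)

  pos-zero : ∀ j → u (pos j) ≡ 0₃
  pos-zero zero    = proj₂ firstZero
  pos-zero (suc j) = LP.∷-injectiveˡ (occursAt-++⁻ʳ u (h (W j)) (block-step (pos j) (pos-zero j)))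

  pos≡ : ∀ j → pos j ≡ n₀ + length (apply h (pref W j))
  pos≡ zero    = sym (+-identityʳ n₀)
  pos≡ (suc j) = begin
    pos j + length (h (W j))             ≡⟨ cong (_+ length (h (W j))) (pos≡ j) ⟩
    n₀ + length H + length (h (W j))     ≡⟨ +-assoc n₀ (length H) _ ⟩
    n₀ + (length H + length (h (W j)))   ≡⟨ cong (n₀ +_) (sym (LP.length-++ H)) ⟩
    n₀ + length (H ++ h (W j))           ≡⟨ cong ((n₀ +_) ∘ length) (sym (apply-pref-suc h W j)) ⟩
    n₀ + length (apply h (pref W (suc j))) ∎
    where
    open ≡-Reasoning
    H = apply h (pref W j)

  parsed : ∀ j → OccursAt u n₀ (apply h (pref W j))
  parsed zero    = refl
  parsed (suc j) = subst (OccursAt u n₀) (sym (apply-pref-suc h W j))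
    (occursAt-++ u (apply h (pref W j)) (parsed j)
      (subst (λ i → OccursAt u i (h (W j))) (pos≡ j)
        (occursAt-++⁻ˡ u (h (W j)) (block-step (pos j) (pos-zero j)))))

  h-suffix : ∃[ n ] ∃[ W ] (∀ i → suffix u n i ≡ applyω h W i)
  h-suffix = n₀ , W , NonErasing.suffix≡applyω h h-nonErasing n₀ parsed

lemma12 : (u : InfWord 3) → Good (applyω f u) → ¬ ContainsFactor u w0110
    → ∃[ n ] ∃[ W ] (∀ i → suffix u n i ≡ applyω h W i)
lemma12 u good no0110 =
  Parsing.h-suffix u (avoided doomed-00) (avoided doomed-11) (avoided doomed-12)
                     (avoided doomed-21) (avoided doomed-222)
  where open Exclusion u good (curry no0110) renaming (doomed-avoided to avoided)
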